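{- Let $m$ and $n$ be positive integers. Then the pair $(P_m,P_n)$ is niche-realizable if and only if $(m,n)\in\{(1,1),(1,2),(2,1),(2,2),(2,3),(3,2),(3,3)\}$.
   Context: $P_k$ denotes the path graph on $k$ vertices. The niche graph of a digraph $D$ is the simple graph with vertex set $V(D)$ in which distinct $u,v$ are adjacent iff there is a vertex $w$ with $(u,w),(v,w)\in A(D)$, or with $(w,u),(w,v)\in A(D)$. For graphs $G_1,G_2$ with $m$ and $n$ vertices, the pair $(G_1,G_2)$ is niche-realizable if the disjoint union of $G_1$ and $G_2$ is the niche graph of an orientation of $K_{m,n}$ with bipartition $(V(G_1),V(G_2))$. -}

module Defs where

open import Data.Nat using (ℕ; suc)
open import Data.Fin using (Fin; toℕ)
open import Data.Sum using (_⊎_; inj₁; inj₂)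
open import Data.Product using (_×_; ∃-syntax)
open import Data.Empty using (⊥)
open import Relation.Nullary using (¬_)
open import Relation.Binary.PropositionalEquality using (_≡_)
open import Function.Bundles using (_⇔_)

Graph : Set → Set₁
Graph V = V → V → Set

Digraph : Set → Set₁
Digraph V = V → V → Set

Niche : {V : Set} → Digraph V → Graph V
Niche {V} D u v =
  ¬ (u ≡ v) × ((∃[ w ] (D u w × D v w)) ⊎ (∃[ w ] (D w u × D w v)))

Path : (k : ℕ) → Graph (Fin k)
Path k i j = (toℕ j ≡ suc (toℕ i)) ⊎ (toℕ i ≡ suc (toℕ j))

DisjointUnion : {V W : Set} → Graph V → Graph W → Graph (V ⊎ W)
DisjointUnion G H (inj₁ a) (inj₁ b) = G a b
DisjointUnion G H (inj₂ a) (inj₂ b) = H a b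
DisjointUnion G H (inj₁ _) (inj₂ _) = ⊥
DisjointUnion G H (inj₂ _) (inj₁ _) = ⊥

IsOrientationKmn : (m n : ℕ) → Digraph (Fin m ⊎ Fin n) → Set
IsOrientationKmn m n D =
  ((x x′ : Fin m) → ¬ D (inj₁ x) (inj₁ x′)) ×
  ((y y′ : Fin n) → ¬ D (inj₂ y) (inj₂ y′)) ×
  ((x : Fin m) (y : Fin n) →
     (D (inj₁ x) (inj₂ y) ⊎ D (inj₂ y) (inj₁ x)) ×
     ¬ (D (inj₁ x) (inj₂ y) × D (inj₂ y) (inj₁ x)))

NicheRealizable : {m n : ℕ} → Graph (Fin m) → Graph (Fin n) → Set₁
NicheRealizable {m} {n} G₁ G₂ =
  ∃[ D ] (IsOrientationKmn m n D ×
          ((u v : Fin m ⊎ Fin n) → Niche D u v ⇔ DisjointUnion G₁ G₂ u v))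

AllowedPair : ℕ → ℕ → Set
AllowedPair m n =
  (m ≡ 1 × n ≡ 1) ⊎ (m ≡ 1 × n ≡ 2) ⊎ (m ≡ 2 × n ≡ 1) ⊎ (m ≡ 2 × n ≡ 2) ⊎
  (m ≡ 2 × n ≡ 3) ⊎ (m ≡ 3 × n ≡ 2) ⊎ (m ≡ 3 × n ≡ 3)

-- At a fixed vertex q of one part, the arcs between q and the other part
-- split that part into two classes: the in-neighbours and the
-- out-neighbours of q. Two vertices of a part are adjacent in the niche
-- graph iff some vertex of the other part puts them in the same class.
-- In P₄ = 0-1-2-3 the non-edges 02 and 03 force 2 and 3 into the same
-- class at every q, so the non-edge 13 separates 1 and 2 at every q,
-- contradicting the edge 12. For (P₃, P₁) the single vertex on the other
-- side would put 0, 1 and 2 into one class. Swapping the parts disposes of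
-- the symmetric cases, and the remaining pairs are realized by explicit
-- orientations.
module Submission where

open import Defs
open import Data.Bool using (Bool; true; false; not; T)
open import Data.Empty using (⊥; ⊥-elim)
open import Data.Fin using (Fin; toℕ; _≟_)
open import Data.Fin.Patterns using (0F; 1F; 2F; 3F)
open import Data.Fin.Properties using (any?; all?)
open import Data.Nat using (ℕ; suc; _+_; _≤_)
import Data.Nat as ℕ
open import Data.Product using (_×_; _,_; ∃; ∃-syntax; proj₁; proj₂)
open import Data.Sum using (_⊎_; inj₁; inj₂; swap; [_,_])
open import Data.Sum.Properties using (≡-dec; swap-↔; inj₁-injective)
open import Data.Unit using (tt)
open import Data.Vec using (Vec; []; _∷_; lookup)
open import Function using (_∘_)
open import Function.Bundles using (_⇔_; mk⇔; _↔_; Inverse; Equivalence)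
open import Function.Construct.Composition using (_⇔-∘_)
open import Relation.Nullary using (¬_; Dec; no)
open import Relation.Nullary.Decidable
  using (True; toWitness; map′; T?; ¬?; _×-dec_; _⊎-dec_; _→-dec_)
open import Relation.Binary.PropositionalEquality
  using (_≡_; _≢_; refl; sym; cong; subst; module ≡-Reasoning)

private
  variable
    V W : Set
    m n : ℕ


module _ (f : V ↔ W) (D : Digraph W) where
  open Inverse f

  private
    D∘to : Digraph V
    D∘to u v = D (to u) (to v)

    to-injective : ∀ {u v} → to u ≡ to v → u ≡ v
    to-injective {u} {v} eq = begin
      u             ≡⟨ sym (strictlyInverseʳ u) ⟩
      from (to u)   ≡⟨ cong from eq ⟩
      from (to v)   ≡⟨ strictlyInverseʳ v ⟩
      v             ∎
      where open ≡-Reasoning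

    arc-into-to∘from : ∀ {u w} → D u w → D u (to (from w))
    arc-into-to∘from {u} {w} = subst (D u) (sym (strictlyInverseˡ w))

    arc-out-of-to∘from : ∀ {u w} → D w u → D (to (from w)) u
    arc-out-of-to∘from {u} {w} = subst (λ x → D x u) (sym (strictlyInverseˡ w))

  niche-relabel : (u v : V) → Niche D∘to u v ⇔ Niche D (to u) (to v)
  niche-relabel u v = mk⇔
    (λ { (u≢v , inj₁ (w , a , b)) → u≢v ∘ to-injective , inj₁ (to w , a , b)
       ; (u≢v , inj₂ (w , a , b)) → u≢v ∘ to-injective , inj₂ (to w , a , b) })
    (λ { (u≢v , inj₁ (w , a , b)) →
           u≢v ∘ cong to , inj₁ (from w , arc-into-to∘from a , arc-into-to∘from b)
       ; (u≢v , inj₂ (w , a , b)) →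
           u≢v ∘ cong to , inj₂ (from w , arc-out-of-to∘from a , arc-out-of-to∘from b) })

disjointUnion-swap : {G₁ : Graph V} {G₂ : Graph W} (u v : W ⊎ V) →
  DisjointUnion G₂ G₁ u v ≡ DisjointUnion G₁ G₂ (swap u) (swap v)
disjointUnion-swap (inj₁ _) (inj₁ _) = refl
disjointUnion-swap (inj₁ _) (inj₂ _) = refl
disjointUnion-swap (inj₂ _) (inj₁ _) = refl
disjointUnion-swap (inj₂ _) (inj₂ _) = refl

nicheRealizable-swap : {G₁ : Graph (Fin m)} {G₂ : Graph (Fin n)} →
  NicheRealizable G₁ G₂ → NicheRealizable G₂ G₁
nicheRealizable-swap {G₁ = G₁} {G₂} (D , (no-arc₁ , no-arc₂ , between) , realizes) =
  D∘swap , (no-arc₂ , no-arc₁ , between-swapped) , realizes-swapped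
  where
  D∘swap : Digraph _
  D∘swap u v = D (swap u) (swap v)

  between-swapped : ∀ y x → (D∘swap (inj₁ y) (inj₂ x) ⊎ D∘swap (inj₂ x) (inj₁ y)) ×
                            ¬ (D∘swap (inj₁ y) (inj₂ x) × D∘swap (inj₂ x) (inj₁ y))
  between-swapped y x = swap (proj₁ (between x y)) , λ (a , b) → proj₂ (between x y) (b , a)

  realizes-swapped : ∀ u v → Niche D∘swap u v ⇔ DisjointUnion G₂ G₁ u v
  realizes-swapped u v rewrite disjointUnion-swap {G₁ = G₁} {G₂} u v =
    realizes (swap u) (swap v) ⇔-∘ niche-relabel swap-↔ D u v


module Sides {P Q : Set} (In Out : P → Q → Set)
             (total : ∀ p q → In p q ⊎ Out p q)
             (exclusive : ∀ p q → ¬ (In p q × Out p q)) where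

  SameSide : P → P → Q → Set
  SameSide p p′ q = (In p q × In p′ q) ⊎ (Out p q × Out p′ q)

  sameSide-trans : ∀ {a b c q} → SameSide a b q → SameSide b c q → SameSide a c q
  sameSide-trans (inj₁ (a , _)) (inj₁ (_ , c)) = inj₁ (a , c)
  sameSide-trans (inj₂ (a , _)) (inj₂ (_ , c)) = inj₂ (a , c)
  sameSide-trans {b = b} {q = q} (inj₁ (_ , b-in)) (inj₂ (b-out , _)) =
    ⊥-elim (exclusive b q (b-in , b-out))
  sameSide-trans {b = b} {q = q} (inj₂ (_ , b-out)) (inj₁ (b-in , _)) =
    ⊥-elim (exclusive b q (b-in , b-out))

  sameSide-twoClasses : ∀ {a b c q} → ¬ SameSide a b q → ¬ SameSide a c q → SameSide b c q
  sameSide-twoClasses {a} {b} {c} {q} a≁b a≁c with total b q | total c q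
  ... | inj₁ b-in  | inj₁ c-in  = inj₁ (b-in , c-in)
  ... | inj₂ b-out | inj₂ c-out = inj₂ (b-out , c-out)
  ... | inj₁ b-in  | inj₂ c-out with total a q
  ...   | inj₁ a-in  = ⊥-elim (a≁b (inj₁ (a-in , b-in)))
  ...   | inj₂ a-out = ⊥-elim (a≁c (inj₂ (a-out , c-out)))
  sameSide-twoClasses {a} {b} {c} {q} a≁b a≁c
      | inj₂ b-out | inj₁ c-in with total a q
  ...   | inj₁ a-in  = ⊥-elim (a≁c (inj₁ (a-in , c-in)))
  ...   | inj₂ a-out = ⊥-elim (a≁b (inj₂ (a-out , b-out)))


module Realization {G₁ : Graph (Fin m)} {G₂ : Graph (Fin n)}
                   (R : NicheRealizable G₁ G₂) where

  private
    D : Digraph (Fin m ⊎ Fin n)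
    D = proj₁ R

    no-arc₁ : (x x′ : Fin m) → ¬ D (inj₁ x) (inj₁ x′)
    no-arc₁ = proj₁ (proj₁ (proj₂ R))

    between : ∀ x y → (D (inj₁ x) (inj₂ y) ⊎ D (inj₂ y) (inj₁ x)) ×
                      ¬ (D (inj₁ x) (inj₂ y) × D (inj₂ y) (inj₁ x))
    between = proj₂ (proj₂ (proj₁ (proj₂ R)))

    realizes : ∀ u v → Niche D u v ⇔ DisjointUnion G₁ G₂ u v
    realizes = proj₂ (proj₂ R)

  open Sides (λ x y → D (inj₁ x) (inj₂ y)) (λ x y → D (inj₂ y) (inj₁ x))
             (λ x y → proj₁ (between x y)) (λ x y → proj₂ (between x y))
    public

  Separated : Fin m → Fin m → Set
  Separated x x′ = x ≢ x′ × ¬ G₁ x x′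

  adjacent⇒sameSide : ∀ {x x′} → G₁ x x′ → ∃[ y ] SameSide x x′ y
  adjacent⇒sameSide {x} {x′} adj with proj₂ (Equivalence.from (realizes (inj₁ x) (inj₁ x′)) adj)
  ... | inj₁ (inj₂ y , both-in)  = y , inj₁ both-in
  ... | inj₂ (inj₂ y , both-out) = y , inj₂ both-out
  ... | inj₁ (inj₁ z , arc , _)  = ⊥-elim (no-arc₁ x z arc)
  ... | inj₂ (inj₁ z , arc , _)  = ⊥-elim (no-arc₁ z x arc)

  separated⇒¬sameSide : ∀ {x x′} → Separated x x′ → ∀ y → ¬ SameSide x x′ y
  separated⇒¬sameSide {x} {x′} (x≢x′ , ¬adj) y same =
    ¬adj (Equivalence.to (realizes (inj₁ x) (inj₁ x′)) (x≢x′ ∘ inj₁-injective , niche same))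
    where
    niche : SameSide x x′ y →
      (∃[ w ] (D (inj₁ x) w × D (inj₁ x′) w)) ⊎ (∃[ w ] (D w (inj₁ x) × D w (inj₁ x′)))
    niche (inj₁ both-in)  = inj₁ (inj₂ y , both-in)
    niche (inj₂ both-out) = inj₂ (inj₂ y , both-out)

  ¬adjacent-by-separations : ∀ {a b c d} →
    Separated a c → Separated a d → Separated b d → ¬ G₁ b c
  ¬adjacent-by-separations {c = c} {d} a∣c a∣d b∣d b~c with adjacent⇒sameSide b~c
  ... | y , b≈c = separated⇒¬sameSide b∣d y (sameSide-trans b≈c c≈d)
    where
    c≈d : SameSide c d y
    c≈d = sameSide-twoClasses (separated⇒¬sameSide a∣c y) (separated⇒¬sameSide a∣d y)

  two-edges⇒¬separated : n ≡ 1 → ∀ {a b c} → G₁ a b → G₁ b c → ¬ Separated a c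
  two-edges⇒¬separated refl a~b b~c a∣c
    with adjacent⇒sameSide a~b | adjacent⇒sameSide b~c
  ... | 0F , a≈b | 0F , b≈c = separated⇒¬sameSide a∣c 0F (sameSide-trans a≈b b≈c)

¬nicheRealizable-long-path : ∀ k (G : Graph (Fin n)) → ¬ NicheRealizable (Path (4 + k)) G
¬nicheRealizable-long-path k G R =
  ¬adjacent-by-separations {a = 0F} {1F} {2F} {3F}
    ((λ ()) , λ { (inj₁ ()) ; (inj₂ ()) })
    ((λ ()) , λ { (inj₁ ()) ; (inj₂ ()) })
    ((λ ()) , λ { (inj₁ ()) ; (inj₂ ()) })
    (inj₁ refl)
  where open Realization R

¬nicheRealizable-P₃-K₁ : (G : Graph (Fin 1)) → ¬ NicheRealizable (Path 3) G
¬nicheRealizable-P₃-K₁ G R =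
  two-edges⇒¬separated refl {0F} {1F} {2F} (inj₁ refl) (inj₁ refl)
    ((λ ()) , λ { (inj₁ ()) ; (inj₂ ()) })
  where open Realization R


-- true at (x , y) orients the edge as x → y, false as y → x.
digraphOf : (Fin m → Fin n → Bool) → Digraph (Fin m ⊎ Fin n)
digraphOf o (inj₁ x) (inj₂ y) = T (o x y)
digraphOf o (inj₂ y) (inj₁ x) = T (not (o x y))
digraphOf o (inj₁ _) (inj₁ _) = ⊥
digraphOf o (inj₂ _) (inj₂ _) = ⊥

digraphOf-isOrientation : (o : Fin m → Fin n → Bool) → IsOrientationKmn m n (digraphOf o)
digraphOf-isOrientation o = (λ _ _ ()) , (λ _ _ ()) , λ x y → one-way (o x y)
  where
  one-way : ∀ b → (T b ⊎ T (not b)) × ¬ (T b × T (not b))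
  one-way true  = inj₁ tt , λ ()
  one-way false = inj₂ tt , λ ()

digraphOf? : (o : Fin m → Fin n → Bool) → ∀ u v → Dec (digraphOf o u v)
digraphOf? o (inj₁ x) (inj₂ y) = T? (o x y)
digraphOf? o (inj₂ y) (inj₁ x) = T? (not (o x y))
digraphOf? o (inj₁ _) (inj₁ _) = no λ ()
digraphOf? o (inj₂ _) (inj₂ _) = no λ ()

any?-⊎ : {P : Fin m ⊎ Fin n → Set} → (∀ w → Dec (P w)) → Dec (∃ P)
any?-⊎ P? = map′
  (λ { (inj₁ (x , p)) → inj₁ x , p ; (inj₂ (y , p)) → inj₂ y , p })
  (λ { (inj₁ x , p) → inj₁ (x , p) ; (inj₂ y , p) → inj₂ (y , p) })
  (any? (P? ∘ inj₁) ⊎-dec any? (P? ∘ inj₂))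

all?-⊎ : {P : Fin m ⊎ Fin n → Set} → (∀ w → Dec (P w)) → Dec (∀ w → P w)
all?-⊎ P? = map′
  (λ (p , q) → [ p , q ])
  (λ p → p ∘ inj₁ , p ∘ inj₂)
  (all? (P? ∘ inj₁) ×-dec all? (P? ∘ inj₂))

_⇔?_ : {A B : Set} → Dec A → Dec B → Dec (A ⇔ B)
A? ⇔? B? = map′ (λ (f , g) → mk⇔ f g) (λ e → Equivalence.to e , Equivalence.from e)
  ((A? →-dec B?) ×-dec (B? →-dec A?))

niche? : {D : Digraph (Fin m ⊎ Fin n)} → (∀ u v → Dec (D u v)) → ∀ u v → Dec (Niche D u v)
niche? D? u v = ¬? (≡-dec _≟_ _≟_ u v) ×-dec
  (any?-⊎ (λ w → D? u w ×-dec D? v w) ⊎-dec any?-⊎ (λ w → D? w u ×-dec D? w v))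

path? : ∀ k (i j : Fin k) → Dec (Path k i j)
path? k i j = (toℕ j ℕ.≟ suc (toℕ i)) ⊎-dec (toℕ i ℕ.≟ suc (toℕ j))

disjointUnion? : {G₁ : Graph (Fin m)} {G₂ : Graph (Fin n)} →
  (∀ x x′ → Dec (G₁ x x′)) → (∀ y y′ → Dec (G₂ y y′)) →
  ∀ u v → Dec (DisjointUnion G₁ G₂ u v)
disjointUnion? G₁? G₂? (inj₁ x) (inj₁ x′) = G₁? x x′
disjointUnion? G₁? G₂? (inj₂ y) (inj₂ y′) = G₂? y y′
disjointUnion? G₁? G₂? (inj₁ _) (inj₂ _) = no λ ()
disjointUnion? G₁? G₂? (inj₂ _) (inj₁ _) = no λ ()

realizesPaths? : (o : Fin m → Fin n → Bool) →
  Dec (∀ u v → Niche (digraphOf o) u v ⇔ DisjointUnion (Path m) (Path n) u v)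
realizesPaths? {m} {n} o = all?-⊎ λ u → all?-⊎ λ v →
  niche? (digraphOf? o) u v ⇔? disjointUnion? (path? m) (path? n) u v

realizedBy : (o : Fin m → Fin n → Bool) → {True (realizesPaths? o)} →
  NicheRealizable (Path m) (Path n)
realizedBy o {ok} = digraphOf o , digraphOf-isOrientation o , toWitness ok

matrix : Vec (Vec Bool n) m → Fin m → Fin n → Bool
matrix rows x y = lookup (lookup rows x) y

nicheRealizable-P₁-P₁ : NicheRealizable (Path 1) (Path 1)
nicheRealizable-P₁-P₁ = realizedBy (matrix ((false ∷ []) ∷ []))

nicheRealizable-P₁-P₂ : NicheRealizable (Path 1) (Path 2)
nicheRealizable-P₁-P₂ = realizedBy (matrix ((false ∷ false ∷ []) ∷ []))

nicheRealizable-P₂-P₂ : NicheRealizable (Path 2) (Path 2)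
nicheRealizable-P₂-P₂ = realizedBy (matrix ((false ∷ false ∷ []) ∷ (false ∷ false ∷ []) ∷ []))

nicheRealizable-P₂-P₃ : NicheRealizable (Path 2) (Path 3)
nicheRealizable-P₂-P₃ = realizedBy (matrix ( (false ∷ false ∷ true ∷ [])
                                            ∷ (false ∷ true  ∷ true ∷ [])
                                            ∷ []))

nicheRealizable-P₃-P₃ : NicheRealizable (Path 3) (Path 3)
nicheRealizable-P₃-P₃ = realizedBy (matrix ( (false ∷ false ∷ true  ∷ [])
                                            ∷ (false ∷ true  ∷ true  ∷ [])
                                            ∷ (true  ∷ true  ∷ false ∷ [])
                                            ∷ []))


allowedPair-of-realizable : ∀ m n → 1 ≤ m → 1 ≤ n →
  NicheRealizable (Path m) (Path n) → AllowedPair m n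
allowedPair-of-realizable (suc (suc (suc (suc k)))) n _ _ R =
  ⊥-elim (¬nicheRealizable-long-path k (Path n) R)
allowedPair-of-realizable m (suc (suc (suc (suc k)))) _ _ R =
  ⊥-elim (¬nicheRealizable-long-path k (Path m) (nicheRealizable-swap R))
allowedPair-of-realizable 3 1 _ _ R = ⊥-elim (¬nicheRealizable-P₃-K₁ (Path 1) R)
allowedPair-of-realizable 1 3 _ _ R =
  ⊥-elim (¬nicheRealizable-P₃-K₁ (Path 1) (nicheRealizable-swap R))
allowedPair-of-realizable 1 1 _ _ _ = inj₁ (refl , refl)
allowedPair-of-realizable 1 2 _ _ _ = inj₂ (inj₁ (refl , refl))
allowedPair-of-realizable 2 1 _ _ _ = inj₂ (inj₂ (inj₁ (refl , refl)))
allowedPair-of-realizable 2 2 _ _ _ = inj₂ (inj₂ (inj₂ (inj₁ (refl , refl))))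
allowedPair-of-realizable 2 3 _ _ _ = inj₂ (inj₂ (inj₂ (inj₂ (inj₁ (refl , refl)))))
allowedPair-of-realizable 3 2 _ _ _ = inj₂ (inj₂ (inj₂ (inj₂ (inj₂ (inj₁ (refl , refl))))))
allowedPair-of-realizable 3 3 _ _ _ = inj₂ (inj₂ (inj₂ (inj₂ (inj₂ (inj₂ (refl , refl))))))

realizable-of-allowedPair : ∀ m n → AllowedPair m n → NicheRealizable (Path m) (Path n)
realizable-of-allowedPair _ _ (inj₁ (refl , refl)) = nicheRealizable-P₁-P₁
realizable-of-allowedPair _ _ (inj₂ (inj₁ (refl , refl))) = nicheRealizable-P₁-P₂
realizable-of-allowedPair _ _ (inj₂ (inj₂ (inj₁ (refl , refl)))) =
  nicheRealizable-swap nicheRealizable-P₁-P₂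
realizable-of-allowedPair _ _ (inj₂ (inj₂ (inj₂ (inj₁ (refl , refl))))) = nicheRealizable-P₂-P₂
realizable-of-allowedPair _ _ (inj₂ (inj₂ (inj₂ (inj₂ (inj₁ (refl , refl)))))) =
  nicheRealizable-P₂-P₃
realizable-of-allowedPair _ _ (inj₂ (inj₂ (inj₂ (inj₂ (inj₂ (inj₁ (refl , refl))))))) =
  nicheRealizable-swap nicheRealizable-P₂-P₃
realizable-of-allowedPair _ _ (inj₂ (inj₂ (inj₂ (inj₂ (inj₂ (inj₂ (refl , refl))))))) =
  nicheRealizable-P₃-P₃

corollary3p8 : (m n : ℕ) → 1 ≤ m → 1 ≤ n →
    NicheRealizable (Path m) (Path n) ⇔ AllowedPair m n
corollary3p8 m n 1≤m 1≤n =
  mk⇔ (allowedPair-of-realizable m n 1≤m 1≤n) (realizable-of-allowedPair m n)
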